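{- Let $\alpha,\beta,\gamma,\beta',\gamma'$ be arbitrary parameters (e.g. indeterminates or complex numbers) and set $\alpha'=0$. Define $\left|{n\atop k}\right|$ for integers $n,k\ge 0$ by $\left|{0\atop k}\right|=\delta_{k,0}$ and \[\left|{n+1\atop k}\right|=(\alpha n+\beta k+\gamma)\left|{n\atop k}\right|+(\alpha' n+\beta' k+\gamma')\left|{n\atop k-1}\right|\qquad(n,k\ge 0),\] with $\left|{n\atop -1}\right|=0$. Then for all $n,k\ge 0$, \[\left|{n\atop k}\right|=\left(\sum_{\substack{i_1,i_2,i_3\ge 0\\ i_1+i_2+i_3=n-k}}{n\brack n-i_1}\binom{n-i_1}{k+i_2}{k+i_2\brace k}\alpha^{i_1}\beta^{i_2}\gamma^{i_3}\right)\left(\prod_{j=1}^k(\gamma'+j\beta')\right).\] In particular $\left|{n\atop k}\right|$ is the product of a polynomial in $\alpha,\beta,\gamma$ alone and a polynomial in $\beta',\gamma'$ alone.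
   Context: ${n\brack m}$ denotes the unsigned Stirling number of the first kind (number of permutations of $n$ elements with $m$ cycles), ${m\brace k}$ the Stirling number of the second kind (number of partitions of an $m$-set into $k$ nonempty blocks), and $\binom{a}{b}$ the binomial coefficient. An empty sum (when $n<k$) is $0$ and an empty product is $1$. $\delta_{k,0}$ is the Kronecker delta. -}

module Defs where

open import Level using (Level)
open import Data.Nat using (ℕ; zero; suc)
import Data.Nat as N
open import Data.Nat.Combinatorics using (_C_)
open import Relation.Nullary using (yes; no)
open import Algebra.Bundles using (CommutativeRing)

stirling1 : ℕ → ℕ → ℕ
stirling1 zero    zero    = 1
stirling1 zero    (suc m) = 0
stirling1 (suc n) zero    = 0
stirling1 (suc n) (suc m) = n N.* stirling1 n (suc m) N.+ stirling1 n m

stirling2 : ℕ → ℕ → ℕ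
stirling2 zero    zero    = 1
stirling2 zero    (suc k) = 0
stirling2 (suc m) zero    = 0
stirling2 (suc m) (suc k) = suc k N.* stirling2 m (suc k) N.+ stirling2 m k

module _ {c ℓ : Level} (R : CommutativeRing c ℓ) where
  open CommutativeRing R hiding (zero)

  ι : ℕ → Carrier
  ι zero    = 0#
  ι (suc n) = 1# + ι n

  _^_ : Carrier → ℕ → Carrier
  x ^ zero  = 1#
  x ^ suc n = x * (x ^ n)

  sumUpTo : ℕ → (ℕ → Carrier) → Carrier
  sumUpTo zero    f = f 0
  sumUpTo (suc n) f = sumUpTo n f + f (suc n)

  prodFrom1 : ℕ → (ℕ → Carrier) → Carrier
  prodFrom1 zero    f = 1#
  prodFrom1 (suc k) f = prodFrom1 k f * f (suc k)

  gstir : (α β γ α' β' γ' : Carrier) → ℕ → ℕ → Carrier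
  gstir α β γ α' β' γ' zero    zero    = 1#
  gstir α β γ α' β' γ' zero    (suc k) = 0#
  gstir α β γ α' β' γ' (suc n) zero    =
    (α * ι n + β * ι zero + γ) * gstir α β γ α' β' γ' n zero
  gstir α β γ α' β' γ' (suc n) (suc k) =
    (α * ι n + β * ι (suc k) + γ) * gstir α β γ α' β' γ' n (suc k)
    + (α' * ι n + β' * ι (suc k) + γ') * gstir α β γ α' β' γ' n k

  indicator : ℕ → ℕ → Carrier
  indicator a b with a N.≟ b
  ... | yes _ = 1#
  ... | no  _ = 0#

  -- Each i_j ≤ n, so ranging over 0..n with the constraint enforced by the
  -- indicator enumerates exactly the index set.
  tripleSum : (α β γ : Carrier) → ℕ → ℕ → Carrier
  tripleSum α β γ n k =
    sumUpTo n λ i₁ → sumUpTo n λ i₂ → sumUpTo n λ i₃ →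
      indicator (i₁ N.+ i₂ N.+ i₃ N.+ k) n *
      (ι (stirling1 n (n N.∸ i₁)) * ι ((n N.∸ i₁) C (k N.+ i₂))
        * ι (stirling2 (k N.+ i₂) k)
        * ((α ^ i₁) * (β ^ i₂) * (γ ^ i₃)))

{-# OPTIONS --safe #-}
module Submission where

-- The triple sum is the (n, k) entry of the matrix product A · G · B of the
-- triangles A n m = [n m] α^(n−m), G m j = C(m, j) γ^(m−j) and
-- B j k = {j k} β^(j−k).  Each of them satisfies a Pascal-type recurrence
-- M (n+1) k = a n k · M n k + M n (k−1) whose weight a depends only on the
-- row (A: αn) or only on the column (G: γ, B: βk), and the product of a
-- row-weighted and a column-weighted such triangle is again one, with the
-- weights added.  So A · G · B obeys the recurrence with weight αn + βk + γ,
-- and scaling its k-th column by ∏_{j ≤ k} (γ' + jβ') turns this into the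
-- recurrence defining |n k| when α' = 0.

open import Defs
open import Level using (Level; _⊔_)
open import Function using (_∘_)
open import Algebra.Bundles using (CommutativeSemiring; CommutativeRing)
open import Data.Nat as ℕ using (ℕ; zero; suc; _≤_; _<_; z≤n; s≤s)
import Data.Nat.Properties as ℕₚ
open import Data.Nat.Combinatorics using (_C_; nCk+nC[k+1]≡[n+1]C[k+1])
open import Data.Nat.Tactic.RingSolver using (solve-∀)
open import Data.Sum using (inj₁; inj₂)
open import Relation.Nullary using (Dec; yes; no; contradiction)
open import Relation.Binary.PropositionalEquality as ≡ using (_≡_; _≢_)

module PascalTriangles {c ℓ : Level} (S : CommutativeSemiring c ℓ) where
  open CommutativeSemiring S
  open import Relation.Binary.Reasoning.Setoid setoid

  record PascalRecurrence (a M : ℕ → ℕ → Carrier) : Set (c ⊔ ℓ) where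
    field
      corner       : M 0 0 ≈ 1#
      first-row    : ∀ k → M 0 (suc k) ≈ 0#
      first-column : ∀ n → M (suc n) 0 ≈ a n 0 * M n 0
      step         : ∀ n k → M (suc n) (suc k) ≈ a n (suc k) * M n (suc k) + M n k

  open PascalRecurrence public

  leftOf : (ℕ → ℕ → Carrier) → ℕ → ℕ → Carrier
  leftOf M n zero    = 0#
  leftOf M n (suc k) = M n k

  module _ {a M : ℕ → ℕ → Carrier} (rec : PascalRecurrence a M) where

    recurrence : ∀ n k → M (suc n) k ≈ a n k * M n k + leftOf M n k
    recurrence n zero    = trans (first-column rec n) (sym (+-identityʳ _))
    recurrence n (suc k) = step rec n k

    vanishes-above-diagonal : ∀ {n m} → n < m → M n m ≈ 0#
    vanishes-above-diagonal {zero}  {suc m} _         = first-row rec m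
    vanishes-above-diagonal {suc n} {suc m} (s≤s n<m) = begin
      M (suc n) (suc m)                  ≈⟨ step rec n m ⟩
      a n (suc m) * M n (suc m) + M n m  ≈⟨ +-cong (trans (*-congˡ M[n,m+1]≈0) (zeroʳ _))
                                                  (vanishes-above-diagonal n<m) ⟩
      0# + 0#                            ≈⟨ +-identityʳ 0# ⟩
      0#                                 ∎
      where M[n,m+1]≈0 = vanishes-above-diagonal (ℕₚ.m<n⇒m<1+n n<m)

  recurrence-cong : ∀ {a b M : ℕ → ℕ → Carrier} → (∀ n k → a n k ≈ b n k) →
                    PascalRecurrence a M → PascalRecurrence b M
  recurrence-cong a≈b rec .corner         = corner rec
  recurrence-cong a≈b rec .first-row k    = first-row rec k
  recurrence-cong a≈b rec .first-column n = trans (first-column rec n) (*-congʳ (a≈b n 0))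
  recurrence-cong a≈b rec .step n k       = trans (step rec n k) (+-congʳ (*-congʳ (a≈b n (suc k))))

module ℕᴾ = PascalTriangles ℕₚ.+-*-commutativeSemiring

stirling1-recurrence : ℕᴾ.PascalRecurrence (λ n _ → n) stirling1
stirling1-recurrence .ℕᴾ.corner               = ≡.refl
stirling1-recurrence .ℕᴾ.first-row k          = ≡.refl
stirling1-recurrence .ℕᴾ.first-column zero    = ≡.refl
stirling1-recurrence .ℕᴾ.first-column (suc n) = ≡.sym (ℕₚ.*-zeroʳ (suc n))
stirling1-recurrence .ℕᴾ.step n k             = ≡.refl

stirling2-recurrence : ℕᴾ.PascalRecurrence (λ _ k → k) stirling2
stirling2-recurrence .ℕᴾ.corner         = ≡.refl
stirling2-recurrence .ℕᴾ.first-row k    = ≡.refl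
stirling2-recurrence .ℕᴾ.first-column n = ≡.refl
stirling2-recurrence .ℕᴾ.step n k       = ≡.refl

binomial-recurrence : ℕᴾ.PascalRecurrence (λ _ _ → 1) _C_
binomial-recurrence .ℕᴾ.corner         = ≡.refl
binomial-recurrence .ℕᴾ.first-row k    = ≡.refl
binomial-recurrence .ℕᴾ.first-column n = ≡.refl
binomial-recurrence .ℕᴾ.step n k       = ≡.sym (begin
  1 ℕ.* (n C suc k) ℕ.+ n C k  ≡⟨ ≡.cong (ℕ._+ n C k) (ℕₚ.*-identityˡ (n C suc k)) ⟩
  n C suc k ℕ.+ n C k          ≡⟨ ℕₚ.+-comm (n C suc k) (n C k) ⟩
  n C k ℕ.+ n C suc k          ≡⟨ nCk+nC[k+1]≡[n+1]C[k+1] n k ⟩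
  suc n C suc k                ∎)
  where open ≡.≡-Reasoning

+-regroup : ∀ a b c d → a ℕ.+ b ℕ.+ c ℕ.+ d ≡ a ℕ.+ (d ℕ.+ b) ℕ.+ c
+-regroup = solve-∀

module _ {c ℓ : Level} (R : CommutativeRing c ℓ) where
  open CommutativeRing R hiding (zero)
  open import Relation.Binary.Reasoning.Setoid setoid
  open import Algebra.Properties.CommutativeSemigroup +-commutativeSemigroup using (interchange)
  open import Algebra.Properties.CommutativeSemigroup *-commutativeSemigroup using (x∙yz≈y∙xz)
  open import Algebra.Properties.Semiring.Mult semiring using (_×_; ×-homo-+; ×1-homo-*)
  open import Algebra.Solver.Ring.NaturalCoefficients.Default commutativeSemiring
  open PascalTriangles commutativeSemiring

  private
    ∑ : ℕ → (ℕ → Carrier) → Carrier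
    ∑ = sumUpTo R

    infixr 8 _^′_
    _^′_ : Carrier → ℕ → Carrier
    _^′_ = _^_ R

  ∑-cong : ∀ n {f g : ℕ → Carrier} → (∀ i → i ≤ n → f i ≈ g i) → ∑ n f ≈ ∑ n g
  ∑-cong zero    f≈g = f≈g 0 z≤n
  ∑-cong (suc n) f≈g =
    +-cong (∑-cong n λ i i≤n → f≈g i (ℕₚ.m≤n⇒m≤1+n i≤n)) (f≈g (suc n) ℕₚ.≤-refl)

  ∑-zero : ∀ n {f : ℕ → Carrier} → (∀ i → i ≤ n → f i ≈ 0#) → ∑ n f ≈ 0#
  ∑-zero zero    f≈0 = f≈0 0 z≤n
  ∑-zero (suc n) f≈0 =
    trans (+-cong (∑-zero n λ i i≤n → f≈0 i (ℕₚ.m≤n⇒m≤1+n i≤n)) (f≈0 (suc n) ℕₚ.≤-refl))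
          (+-identityʳ 0#)

  ∑-distrib-+ : ∀ n (f g : ℕ → Carrier) → ∑ n (λ i → f i + g i) ≈ ∑ n f + ∑ n g
  ∑-distrib-+ zero    f g = refl
  ∑-distrib-+ (suc n) f g = trans (+-congʳ (∑-distrib-+ n f g)) (interchange _ _ _ _)

  *-distribˡ-∑ : ∀ n x (f : ℕ → Carrier) → x * ∑ n f ≈ ∑ n (λ i → x * f i)
  *-distribˡ-∑ zero    x f = refl
  *-distribˡ-∑ (suc n) x f = trans (distribˡ x _ _) (+-congʳ (*-distribˡ-∑ n x f))

  ∑-unfoldˡ : ∀ n (f : ℕ → Carrier) → ∑ (suc n) f ≈ f 0 + ∑ n (λ i → f (suc i))
  ∑-unfoldˡ zero    f = refl
  ∑-unfoldˡ (suc n) f = trans (+-congʳ (∑-unfoldˡ n f)) (+-assoc _ _ _)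

  ∑-reverse : ∀ n (f : ℕ → Carrier) → ∑ n (λ i → f (n ℕ.∸ i)) ≈ ∑ n f
  ∑-reverse zero    f = refl
  ∑-reverse (suc n) f =
    trans (∑-unfoldˡ n (λ i → f (suc n ℕ.∸ i))) (trans (+-congˡ (∑-reverse n f)) (+-comm _ _))

  ∑-truncate : ∀ {m} n (f : ℕ → Carrier) → m ≤ n → (∀ i → m < i → f i ≈ 0#) → ∑ n f ≈ ∑ m f
  ∑-truncate zero    f z≤n f≈0 = refl
  ∑-truncate (suc n) f m≤1+n f≈0 with ℕₚ.m≤n⇒m<n∨m≡n m≤1+n
  ... | inj₂ ≡.refl    = refl
  ... | inj₁ (s≤s m≤n) =
    trans (+-cong (∑-truncate n f m≤n f≈0) (f≈0 (suc n) (s≤s m≤n))) (+-identityʳ _)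

  ∑-shift : ∀ k n (f : ℕ → Carrier) → (∀ j → j < k → f j ≈ 0#) →
            ∑ (n ℕ.+ k) f ≈ ∑ n (λ i → f (k ℕ.+ i))
  ∑-shift zero    n f f≈0 rewrite ℕₚ.+-identityʳ n = refl
  ∑-shift (suc k) n f f≈0 rewrite ℕₚ.+-suc n k = begin
    ∑ (suc (n ℕ.+ k)) f                ≈⟨ ∑-unfoldˡ (n ℕ.+ k) f ⟩
    f 0 + ∑ (n ℕ.+ k) (λ i → f (suc i)) ≈⟨ +-congʳ (f≈0 0 (s≤s z≤n)) ⟩
    0# + ∑ (n ℕ.+ k) (λ i → f (suc i))  ≈⟨ +-identityˡ _ ⟩
    ∑ (n ℕ.+ k) (λ i → f (suc i))       ≈⟨ ∑-shift k n _ (λ j j<k → f≈0 (suc j) (s≤s j<k)) ⟩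
    ∑ n (λ i → f (suc k ℕ.+ i))        ∎

  ∑-delta : ∀ n t (d f : ℕ → Carrier) → t ≤ n → d t ≈ 1# → (∀ i → i ≢ t → d i ≈ 0#) →
            ∑ n (λ i → d i * f i) ≈ f t
  ∑-delta zero .zero d f z≤n dt≈1 _ = trans (*-congʳ dt≈1) (*-identityˡ _)
  ∑-delta (suc n) t d f t≤1+n dt≈1 di≈0 with ℕₚ.m≤n⇒m<n∨m≡n t≤1+n
  ... | inj₂ ≡.refl =
    trans (+-cong (∑-zero n λ i i≤n → trans (*-congʳ (di≈0 i (ℕₚ.<⇒≢ (s≤s i≤n)))) (zeroˡ _))
                  (trans (*-congʳ dt≈1) (*-identityˡ _)))
          (+-identityˡ _)
  ... | inj₁ (s≤s t≤n) =
    trans (+-cong (∑-delta n t d f t≤n dt≈1 di≈0)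
                  (trans (*-congʳ (di≈0 (suc n) (ℕₚ.>⇒≢ (s≤s t≤n)))) (zeroˡ _)))
          (+-identityʳ _)

  indicator-≡ : ∀ {a b} → a ≡ b → indicator R a b ≈ 1#
  indicator-≡ {a} {b} a≡b with a ℕ.≟ b
  ... | yes _  = refl
  ... | no a≢b = contradiction a≡b a≢b

  indicator-≢ : ∀ {a b} → a ≢ b → indicator R a b ≈ 0#
  indicator-≢ {a} {b} a≢b with a ℕ.≟ b
  ... | yes a≡b = contradiction a≡b a≢b
  ... | no _    = refl

  ι-cong : ∀ {m n} → m ≡ n → ι R m ≈ ι R n
  ι-cong m≡n = reflexive (≡.cong (ι R) m≡n)

  ι≈×1# : ∀ n → ι R n ≈ n × 1#
  ι≈×1# zero    = refl
  ι≈×1# (suc n) = +-congˡ (ι≈×1# n)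

  ι-homo-+ : ∀ m n → ι R (m ℕ.+ n) ≈ ι R m + ι R n
  ι-homo-+ m n = begin
    ι R (m ℕ.+ n)        ≈⟨ ι≈×1# (m ℕ.+ n) ⟩
    (m ℕ.+ n) × 1#       ≈⟨ ×-homo-+ 1# m n ⟩
    m × 1# + n × 1#      ≈⟨ +-cong (ι≈×1# m) (ι≈×1# n) ⟨
    ι R m + ι R n        ∎

  ι-homo-* : ∀ m n → ι R (m ℕ.* n) ≈ ι R m * ι R n
  ι-homo-* m n = begin
    ι R (m ℕ.* n)        ≈⟨ ι≈×1# (m ℕ.* n) ⟩
    (m ℕ.* n) × 1#       ≈⟨ ×1-homo-* m n ⟩
    (m × 1#) * (n × 1#)  ≈⟨ *-cong (ι≈×1# m) (ι≈×1# n) ⟨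
    ι R m * ι R n        ∎

  weighted : (ℕ → ℕ → ℕ) → Carrier → ℕ → ℕ → Carrier
  weighted c x n m = ι R (c n m) * x ^′ (n ℕ.∸ m)

  private
    pull-weight : ∀ k s y p → k * s * (y * p) ≈ y * k * (s * p)
    pull-weight = solve 4 (λ k s y p → k :* s :* (y :* p) := y :* k :* (s :* p)) refl

  module _ {K c : ℕ → ℕ → ℕ} (rec : ℕᴾ.PascalRecurrence K c) (x : Carrier) where

    weighted-recurrence : PascalRecurrence (λ n m → x * ι R (K n m)) (weighted c x)
    weighted-recurrence .corner =
      trans (*-identityʳ _) (trans (ι-cong (ℕᴾ.corner rec)) (+-identityʳ 1#))
    weighted-recurrence .first-row k =
      trans (*-congʳ (ι-cong (ℕᴾ.first-row rec k))) (zeroˡ _)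
    weighted-recurrence .first-column n = begin
      ι R (c (suc n) 0) * (x * x ^′ n)
        ≈⟨ *-congʳ (trans (ι-cong (ℕᴾ.first-column rec n)) (ι-homo-* (K n 0) (c n 0))) ⟩
      ι R (K n 0) * ι R (c n 0) * (x * x ^′ n)
        ≈⟨ pull-weight _ _ _ _ ⟩
      x * ι R (K n 0) * (ι R (c n 0) * x ^′ n) ∎
    weighted-recurrence .step n m = begin
      ι R (c (suc n) (suc m)) * x ^′ (n ℕ.∸ m)
        ≈⟨ *-congʳ ι-step ⟩
      (ι R (K n (suc m)) * ι R (c n (suc m)) + ι R (c n m)) * x ^′ (n ℕ.∸ m)
        ≈⟨ distribʳ _ _ _ ⟩
      ι R (K n (suc m)) * ι R (c n (suc m)) * x ^′ (n ℕ.∸ m) + weighted c x n m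
        ≈⟨ +-congʳ (lower-power (m ℕ.<? n)) ⟩
      x * ι R (K n (suc m)) * weighted c x n (suc m) + weighted c x n m ∎
      where
      ι-step : ι R (c (suc n) (suc m)) ≈ ι R (K n (suc m)) * ι R (c n (suc m)) + ι R (c n m)
      ι-step = trans (ι-cong (ℕᴾ.step rec n m))
                     (trans (ι-homo-+ (K n (suc m) ℕ.* c n (suc m)) (c n m))
                            (+-congʳ (ι-homo-* (K n (suc m)) (c n (suc m)))))

      lower-power : Dec (m < n) → ι R (K n (suc m)) * ι R (c n (suc m)) * x ^′ (n ℕ.∸ m)
                                  ≈ x * ι R (K n (suc m)) * weighted c x n (suc m)
      lower-power (yes m<n) =
        trans (*-congˡ (reflexive (≡.cong (x ^′_) (ℕₚ.+-∸-assoc 1 m<n)))) (pull-weight _ _ _ _)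
      lower-power (no m≮n) =
        trans (trans (*-congʳ (trans (*-congˡ c≈0) (zeroʳ _))) (zeroˡ _))
              (sym (trans (*-congˡ (trans (*-congʳ c≈0) (zeroˡ _))) (zeroʳ _)))
        where
        c≈0 : ι R (c n (suc m)) ≈ 0#
        c≈0 = ι-cong (ℕᴾ.vanishes-above-diagonal rec (s≤s (ℕₚ.≮⇒≥ m≮n)))

  -- Matrix product of lower-triangular arrays, so the sum may stop at m = n.
  _⊗_ : (ℕ → ℕ → Carrier) → (ℕ → ℕ → Carrier) → ℕ → ℕ → Carrier
  (M ⊗ N) n k = ∑ n (λ m → M n m * N m k)

  module _ {a : ℕ → Carrier} {M : ℕ → ℕ → Carrier} (rec : PascalRecurrence (λ n _ → a n) M) where

    ∑-next-row : ∀ n (f : ℕ → Carrier) →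
                 ∑ (suc n) (λ m → M (suc n) m * f m)
                 ≈ a n * ∑ n (λ m → M n m * f m) + ∑ n (λ m → M n m * f (suc m))
    ∑-next-row n f = begin
      ∑ (suc n) (λ m → M (suc n) m * f m)
        ≈⟨ ∑-unfoldˡ n _ ⟩
      M (suc n) 0 * f 0 + ∑ n (λ m → M (suc n) (suc m) * f (suc m))
        ≈⟨ +-cong (trans (*-congʳ (first-column rec n)) (*-assoc _ _ _))
                  (∑-cong n λ m _ → trans (*-congʳ (step rec n m)) (distribʳ _ _ _)) ⟩
      a n * (M n 0 * f 0) + ∑ n (λ m → a n * M n (suc m) * f (suc m) + M n m * f (suc m))
        ≈⟨ +-congˡ (trans (∑-distrib-+ n _ _) (+-congʳ (∑-cong n λ m _ → *-assoc _ _ _))) ⟩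
      a n * (M n 0 * f 0) + (∑ n (λ m → a n * (M n (suc m) * f (suc m))) + ∑ n (λ m → M n m * f (suc m)))
        ≈⟨ trans (sym (+-assoc _ _ _)) (+-congʳ (+-congˡ (sym (*-distribˡ-∑ n (a n) _)))) ⟩
      a n * (M n 0 * f 0) + a n * ∑ n (λ m → M n (suc m) * f (suc m)) + ∑ n (λ m → M n m * f (suc m))
        ≈⟨ +-congʳ (trans (sym (distribˡ _ _ _)) (*-congˡ (sym (∑-unfoldˡ n _)))) ⟩
      a n * ∑ (suc n) (λ m → M n m * f m) + ∑ n (λ m → M n m * f (suc m))
        ≈⟨ +-congʳ (*-congˡ (∑-truncate (suc n) _ (ℕₚ.n≤1+n n) λ m n<m →
             trans (*-congʳ (vanishes-above-diagonal rec n<m)) (zeroˡ _))) ⟩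
      a n * ∑ n (λ m → M n m * f m) + ∑ n (λ m → M n m * f (suc m)) ∎

  module _ {a b : ℕ → Carrier} {M N : ℕ → ℕ → Carrier}
           (recM : PascalRecurrence (λ n _ → a n) M) (recN : PascalRecurrence (λ _ k → b k) N) where

    ⊗-next-row : ∀ n k → (M ⊗ N) (suc n) k
                         ≈ (a n + b k) * (M ⊗ N) n k + ∑ n (λ m → M n m * leftOf N m k)
    ⊗-next-row n k = begin
      (M ⊗ N) (suc n) k
        ≈⟨ ∑-next-row recM n (λ m → N m k) ⟩
      a n * (M ⊗ N) n k + ∑ n (λ m → M n m * N (suc m) k)
        ≈⟨ +-congˡ (∑-cong n λ m _ → trans (*-congˡ (recurrence recN m k)) (distribˡ _ _ _)) ⟩
      a n * (M ⊗ N) n k + ∑ n (λ m → M n m * (b k * N m k) + M n m * leftOf N m k)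
        ≈⟨ +-congˡ (∑-distrib-+ n _ _) ⟩
      a n * (M ⊗ N) n k + (∑ n (λ m → M n m * (b k * N m k)) + ∑ n (λ m → M n m * leftOf N m k))
        ≈⟨ +-congˡ (+-congʳ (trans (∑-cong n λ m _ → x∙yz≈y∙xz _ _ _) (sym (*-distribˡ-∑ n (b k) _)))) ⟩
      a n * (M ⊗ N) n k + (b k * (M ⊗ N) n k + ∑ n (λ m → M n m * leftOf N m k))
        ≈⟨ trans (sym (+-assoc _ _ _)) (+-congʳ (sym (distribʳ _ _ _))) ⟩
      (a n + b k) * (M ⊗ N) n k + ∑ n (λ m → M n m * leftOf N m k) ∎

    ⊗-recurrence : PascalRecurrence (λ n k → a n + b k) (M ⊗ N)
    ⊗-recurrence .corner         = trans (*-cong (corner recM) (corner recN)) (*-identityˡ 1#)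
    ⊗-recurrence .first-row k    = trans (*-congˡ (first-row recN k)) (zeroʳ _)
    ⊗-recurrence .first-column n =
      trans (⊗-next-row n 0) (trans (+-congˡ (∑-zero n λ m _ → zeroʳ _)) (+-identityʳ _))
    ⊗-recurrence .step n k       = ⊗-next-row n (suc k)

  triangleProduct : Carrier → Carrier → Carrier → ℕ → ℕ → Carrier
  triangleProduct α β γ = weighted stirling1 α ⊗ (weighted _C_ γ ⊗ weighted stirling2 β)

  triangleProduct-recurrence : ∀ α β γ →
    PascalRecurrence (λ n k → α * ι R n + β * ι R k + γ) (triangleProduct α β γ)
  triangleProduct-recurrence α β γ = recurrence-cong weights
    (⊗-recurrence (weighted-recurrence stirling1-recurrence α)
                  (⊗-recurrence (weighted-recurrence binomial-recurrence γ)
                                (weighted-recurrence stirling2-recurrence β)))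
    where
    weights : ∀ n k → α * ι R n + (γ * ι R 1 + β * ι R k) ≈ α * ι R n + β * ι R k + γ
    weights n k = trans (+-congˡ (+-congʳ (trans (*-congˡ (+-identityʳ 1#)) (*-identityʳ γ))))
                        (solve 3 (λ x y z → x :+ (z :+ y) := x :+ y :+ z) refl _ _ _)

  module _ (α β γ : Carrier) (n k : ℕ) where
    private
      A = weighted stirling1 α
      G = weighted _C_ γ
      B = weighted stirling2 β

      summand : ℕ → ℕ → ℕ → Carrier
      summand i₁ i₂ i₃ = ι R (stirling1 n (n ℕ.∸ i₁)) * ι R ((n ℕ.∸ i₁) C (k ℕ.+ i₂))
                         * ι R (stirling2 (k ℕ.+ i₂) k) * (α ^′ i₁ * β ^′ i₂ * γ ^′ i₃)

    module _ (i₁ i₂ : ℕ) (i₁≤n : i₁ ≤ n) where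
      private
        j = i₁ ℕ.+ (k ℕ.+ i₂)

      -- When i₁ + i₂ + k > n no i₃ fits, but then the binomial factor vanishes as well.
      ∑-over-i₃ :
        ∑ n (λ i₃ → indicator R (i₁ ℕ.+ i₂ ℕ.+ i₃ ℕ.+ k) n * summand i₁ i₂ i₃)
        ≈ A n (n ℕ.∸ i₁) * (G (n ℕ.∸ i₁) (k ℕ.+ i₂) * B (k ℕ.+ i₂) k)
      ∑-over-i₃ with j ℕ.≤? n
      ... | yes j≤n = begin
        ∑ n (λ i₃ → indicator R (i₁ ℕ.+ i₂ ℕ.+ i₃ ℕ.+ k) n * summand i₁ i₂ i₃)
          ≈⟨ ∑-delta n (n ℕ.∸ j) _ _ (ℕₚ.m∸n≤m n j) (indicator-≡ at-i₃) (λ i₃ → indicator-≢ ∘ off-i₃ i₃) ⟩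
        summand i₁ i₂ (n ℕ.∸ j)
          ≈⟨ regroup _ _ _ _ _ _ ⟩
        ι R (stirling1 n (n ℕ.∸ i₁)) * α ^′ i₁
          * (ι R ((n ℕ.∸ i₁) C (k ℕ.+ i₂)) * γ ^′ (n ℕ.∸ j) * (ι R (stirling2 (k ℕ.+ i₂) k) * β ^′ i₂))
          ≈⟨ *-cong (*-congˡ (^′-cong (ℕₚ.m∸[m∸n]≡n i₁≤n)))
                    (*-cong (*-congˡ (^′-cong (ℕₚ.∸-+-assoc n i₁ (k ℕ.+ i₂))))
                            (*-congˡ (^′-cong (ℕₚ.m+n∸m≡n k i₂)))) ⟨
        A n (n ℕ.∸ i₁) * (G (n ℕ.∸ i₁) (k ℕ.+ i₂) * B (k ℕ.+ i₂) k) ∎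
        where
        at-i₃ : i₁ ℕ.+ i₂ ℕ.+ (n ℕ.∸ j) ℕ.+ k ≡ n
        at-i₃ = ≡.trans (+-regroup i₁ i₂ (n ℕ.∸ j) k) (ℕₚ.m+[n∸m]≡n j≤n)
        off-i₃ : ∀ i₃ → i₃ ≢ n ℕ.∸ j → i₁ ℕ.+ i₂ ℕ.+ i₃ ℕ.+ k ≢ n
        off-i₃ i₃ i₃≢ eq = i₃≢ (≡.trans (≡.sym (ℕₚ.m+n∸m≡n j i₃))
                                       (≡.cong (ℕ._∸ j) (≡.trans (≡.sym (+-regroup i₁ i₂ i₃ k)) eq)))
        ^′-cong : ∀ {x p q} → p ≡ q → x ^′ p ≈ x ^′ q
        ^′-cong p≡q = reflexive (≡.cong (_ ^′_) p≡q)
        regroup : ∀ a b c x y z → a * b * c * (x * y * z) ≈ a * x * (b * z * (c * y))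
        regroup = solve 6 (λ a b c x y z → a :* b :* c :* (x :* y :* z)
                                        := a :* x :* (b :* z :* (c :* y))) refl
      ... | no j≰n = begin
        ∑ n (λ i₃ → indicator R (i₁ ℕ.+ i₂ ℕ.+ i₃ ℕ.+ k) n * summand i₁ i₂ i₃)
          ≈⟨ ∑-zero n (λ i₃ _ → trans (*-congʳ (indicator-≢ (j≰n ∘ j≤ i₃))) (zeroˡ _)) ⟩
        0#
          ≈⟨ trans (*-congˡ (trans (*-congʳ G≈0) (zeroˡ _))) (zeroʳ _) ⟨
        A n (n ℕ.∸ i₁) * (G (n ℕ.∸ i₁) (k ℕ.+ i₂) * B (k ℕ.+ i₂) k) ∎
        where
        j≤ : ∀ i₃ → i₁ ℕ.+ i₂ ℕ.+ i₃ ℕ.+ k ≡ n → j ≤ n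
        j≤ i₃ eq = ≡.subst (j ≤_) (≡.trans (≡.sym (+-regroup i₁ i₂ i₃ k)) eq) (ℕₚ.m≤m+n j i₃)
        G≈0 : G (n ℕ.∸ i₁) (k ℕ.+ i₂) ≈ 0#
        G≈0 = vanishes-above-diagonal (weighted-recurrence binomial-recurrence γ)
                (ℕₚ.+-cancelˡ-< i₁ _ _ (≡.subst (ℕ._< j) (≡.sym (ℕₚ.m+[n∸m]≡n i₁≤n)) (ℕₚ.≰⇒> j≰n)))

    ∑-over-i₂ : ∀ m → m ≤ n → ∑ n (λ i₂ → G m (k ℕ.+ i₂) * B (k ℕ.+ i₂) k) ≈ (G ⊗ B) m k
    ∑-over-i₂ m m≤n = begin
      ∑ n (λ i₂ → G m (k ℕ.+ i₂) * B (k ℕ.+ i₂) k)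
        ≈⟨ ∑-shift k n _ (λ j j<k → trans (*-congˡ (vanishes-above-diagonal B-rec j<k)) (zeroʳ _)) ⟨
      ∑ (n ℕ.+ k) (λ j → G m j * B j k)
        ≈⟨ ∑-truncate (n ℕ.+ k) _ (ℕₚ.≤-trans m≤n (ℕₚ.m≤m+n n k))
             (λ j m<j → trans (*-congʳ (vanishes-above-diagonal G-rec m<j)) (zeroˡ _)) ⟩
      (G ⊗ B) m k ∎
      where
      G-rec = weighted-recurrence binomial-recurrence γ
      B-rec = weighted-recurrence stirling2-recurrence β

    tripleSum≈triangleProduct : tripleSum R α β γ n k ≈ triangleProduct α β γ n k
    tripleSum≈triangleProduct = begin
      tripleSum R α β γ n k
        ≈⟨ ∑-cong n (λ i₁ i₁≤n → ∑-cong n λ i₂ _ → ∑-over-i₃ i₁ i₂ i₁≤n) ⟩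
      ∑ n (λ i₁ → ∑ n λ i₂ → A n (n ℕ.∸ i₁) * (G (n ℕ.∸ i₁) (k ℕ.+ i₂) * B (k ℕ.+ i₂) k))
        ≈⟨ ∑-cong n (λ i₁ _ → *-distribˡ-∑ n _ _) ⟨
      ∑ n (λ i₁ → A n (n ℕ.∸ i₁) * ∑ n λ i₂ → G (n ℕ.∸ i₁) (k ℕ.+ i₂) * B (k ℕ.+ i₂) k)
        ≈⟨ ∑-reverse n (λ m → A n m * ∑ n λ i₂ → G m (k ℕ.+ i₂) * B (k ℕ.+ i₂) k) ⟩
      ∑ n (λ m → A n m * ∑ n λ i₂ → G m (k ℕ.+ i₂) * B (k ℕ.+ i₂) k)
        ≈⟨ ∑-cong n (λ m m≤n → *-congˡ (∑-over-i₂ m m≤n)) ⟩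
      triangleProduct α β γ n k ∎

  module _ (α β γ β' γ' : Carrier) {T : ℕ → ℕ → Carrier}
           (rec : PascalRecurrence (λ n k → α * ι R n + β * ι R k + γ) T) where
    private
      P : ℕ → Carrier
      P k = prodFrom1 R k (λ j → γ' + ι R j * β')

    gstir-factorises : ∀ n k → gstir R α β γ 0# β' γ' n k ≈ T n k * P k
    gstir-factorises zero    zero    = sym (trans (*-identityʳ _) (corner rec))
    gstir-factorises zero    (suc k) = sym (trans (*-congʳ (first-row rec k)) (zeroˡ _))
    gstir-factorises (suc n) zero    = begin
      w * gstir R α β γ 0# β' γ' n 0  ≈⟨ *-congˡ (gstir-factorises n 0) ⟩
      w * (T n 0 * 1#)                ≈⟨ *-assoc _ _ _ ⟨
      w * T n 0 * 1#                  ≈⟨ *-congʳ (first-column rec n) ⟨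
      T (suc n) 0 * 1#                ∎
      where w = α * ι R n + β * ι R 0 + γ
    gstir-factorises (suc n) (suc k) = begin
      w * gstir R α β γ 0# β' γ' n (suc k)
        + (0# * ι R n + β' * ι R (suc k) + γ') * gstir R α β γ 0# β' γ' n k
        ≈⟨ +-cong (*-congˡ (gstir-factorises n (suc k)))
                  (*-cong (column-weight _ _ _ _) (gstir-factorises n k)) ⟩
      w * (T n (suc k) * (P k * e)) + e * (T n k * P k)
        ≈⟨ collect _ _ _ _ _ ⟩
      (w * T n (suc k) + T n k) * (P k * e)
        ≈⟨ *-congʳ (step rec n k) ⟨
      T (suc n) (suc k) * (P k * e) ∎
      where
      w = α * ι R n + β * ι R (suc k) + γ
      e = γ' + ι R (suc k) * β'
      column-weight : ∀ x y z u → 0# * x + y * z + u ≈ u + z * y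
      column-weight = solve 4 (λ x y z u → con 0 :* x :+ y :* z :+ u := u :+ z :* y) refl
      collect : ∀ w t₁ t₀ p e → w * (t₁ * (p * e)) + e * (t₀ * p) ≈ (w * t₁ + t₀) * (p * e)
      collect = solve 5 (λ w t₁ t₀ p e → w :* (t₁ :* (p :* e)) :+ e :* (t₀ :* p)
                                       := (w :* t₁ :+ t₀) :* (p :* e)) refl

mainTheorem3 : ∀ {c ℓ : Level} (R : CommutativeRing c ℓ) →
    let open CommutativeRing R in
    ∀ (α β γ β' γ' : Carrier) (n k : ℕ) →
      gstir R α β γ 0# β' γ' n k
        ≈ tripleSum R α β γ n k * prodFrom1 R k (λ j → γ' + ι R j * β')
mainTheorem3 R α β γ β' γ' n k =
  trans (gstir-factorises R α β γ β' γ' (triangleProduct-recurrence R α β γ) n k)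
        (*-congʳ (sym (tripleSum≈triangleProduct R α β γ n k)))
  where open CommutativeRing R
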